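{- Let $k\ge 1$ be an integer and let $S=s_1,s_2,\dots$ be a (finite or infinite) sequence. Then $S$ has a $k$-bad sequence of indices $i_1,\dots,i_{2r}$ with $2r\le 4$ and with associated $m\le 3$ if and only if $s_i=s_j$ for some indices $i<j<i+2k$.
   Context: For a sequence $S=s_1,s_2,\dots$ and a positive integer $k$, a sequence of indices $i_1,i_2,\dots,i_{2r}$ ($r\ge1$) is called $k$-bad for $S$ if there is an integer $m$ with $1<m\le 2r$ such that: (a) $s_{i_1},\dots,s_{i_{2r}}$ is a repetition, i.e. $s_{i_j}=s_{i_{j+r}}$ for $1\le j\le r$; (b) $i_1>i_2>\dots>i_m<i_{m+1}<\dots<i_{2r}$; (c) $|i_j-i_{j+1}|\le k$ for all $1\le j<2r$; (d) $i_{m+1}<i_m+k$ if $m<2r$. The number $m$ is the associated $m$. -}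

module Defs where

open import Data.Nat using (ℕ; suc; _+_; _≤_; _<_; ∣_-_∣)
open import Data.Maybe using (Maybe; just; nothing)
open import Data.Unit using (⊤)
open import Data.Product using (_×_)
open import Relation.Binary.PropositionalEquality using (_≡_)

-- A (finite or infinite) sequence s₁, s₂, … is given by a function
-- s : ℕ → A (1-based; s 0 and values beyond the length are ignored)
-- together with its length: nothing = infinite, just L = s₁ … s_L.
InRange : Maybe ℕ → ℕ → Set
InRange nothing  i = ⊤
InRange (just L) i = i ≤ L

ValidIdx : Maybe ℕ → ℕ → Set
ValidIdx len i = 1 ≤ i × InRange len i

-- The index sequence i₁,…,i_{2r} is given as idx : ℕ → ℕ,
-- where only idx 1, …, idx (r + r) matter.
-- KBad s len k r idx m : "idx is k-bad for S with associated m".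
KBad : {A : Set} → (ℕ → A) → Maybe ℕ → ℕ → ℕ → (ℕ → ℕ) → ℕ → Set
KBad s len k r idx m =
  1 ≤ r ×
  (∀ j → 1 ≤ j → j ≤ r + r → ValidIdx len (idx j)) ×
  1 < m × m ≤ r + r ×
  (∀ j → 1 ≤ j → j ≤ r → s (idx j) ≡ s (idx (j + r))) ×
  (∀ j → 1 ≤ j → j < m → idx (suc j) < idx j) ×
  (∀ j → m ≤ j → j < r + r → idx j < idx (suc j)) ×
  (∀ j → 1 ≤ j → j < r + r → ∣ idx j - idx (suc j) ∣ ≤ k) ×
  (m < r + r → idx (suc m) < idx m + k)

module Submission where

-- A bad sequence with r = 1 is a pair i₂ < i₁ ≤ i₂ + k carrying equal letters.
-- For r = 2 and m ≤ 3 the sequence has one valley v, and the two positions just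
-- above it that carry the same letter (i₁, i₃ if m = 2; i₂, i₄ if m = 3) both lie in
-- (v, v + k], one of them strictly below v + k; so they are less than k apart. If
-- they coincide, the other repeated pair is v and a position at most k above that
-- common peak, hence less than 2k above v.
-- Conversely a repeat at positions i < j is itself a bad pair when j ≤ i + k, and
-- otherwise j ∸ k, i, j ∸ k, j is bad with m = 2.

open import Defs
open import Data.Nat using (ℕ; suc; z≤n; s≤s; _+_; _∸_; _≤_; _<_; ∣_-_∣; _≤?_)
open import Data.Nat.Properties
open import Data.Maybe using (Maybe; just; nothing)
open import Data.Product using (_×_; _,_; ∃-syntax)
open import Data.Sum using (_⊎_; inj₁; inj₂; reduce)
open import Data.Empty using (⊥-elim)
open import Function.Bundles using (_⇔_; mk⇔)
open import Relation.Nullary using (¬_; yes; no)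
open import Relation.Binary using (tri<; tri≈; tri>)
open import Relation.Binary.PropositionalEquality using (_≡_; refl; sym; subst)

m≤n⇒n≤m+o⇒∣m-n∣≤o : ∀ {m n o} → m ≤ n → n ≤ m + o → ∣ m - n ∣ ≤ o
m≤n⇒n≤m+o⇒∣m-n∣≤o {m} {n} m≤n n≤m+o =
  subst (_≤ _) (sym (m≤n⇒∣m-n∣≡n∸m m≤n)) (m≤n+o⇒m∸n≤o n m n≤m+o)

∣m-n∣≤o⇒m≤n+o : ∀ {m n o} → ∣ m - n ∣ ≤ o → m ≤ n + o
∣m-n∣≤o⇒m≤n+o {m} {n} h = ≤-trans (m≤n+∣m-n∣ m n) (+-monoʳ-≤ n h)

∣m-n∣≤o⇒n≤m+o : ∀ {m n o} → ∣ m - n ∣ ≤ o → n ≤ m + o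
∣m-n∣≤o⇒n≤m+o {m} {n} h = ∣m-n∣≤o⇒m≤n+o (subst (_≤ _) (∣-∣-comm m n) h)

m<n+o⇒m<n+[o+o] : ∀ {m n o} → m < n + o → m < n + (o + o)
m<n+o⇒m<n+[o+o] {n = n} {o} h = <-≤-trans h (+-monoʳ-≤ n (m≤m+n o o))

m≤n+o⇒m<n+[o+o] : ∀ {m n o} → 1 ≤ o → m ≤ n + o → m < n + (o + o)
m≤n+o⇒m<n+[o+o] {n = n} {o} 1≤o h = ≤-<-trans h (+-monoʳ-< n (m<m+n o 1≤o))

m≤n+o⇒n<p+o⇒m<p+[o+o] : ∀ {m n o p} → m ≤ n + o → n < p + o → m < p + (o + o)
m≤n+o⇒n<p+o⇒m<p+[o+o] {m} {o = o} {p} h₁ h₂ =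
  subst (m <_) (+-assoc p o o) (≤-<-trans h₁ (+-monoˡ-< o h₂))

inRange-mono : ∀ len {i j} → i ≤ j → InRange len j → InRange len i
inRange-mono nothing  _   _ = _
inRange-mono (just L) i≤j j≤L = ≤-trans i≤j j≤L

validIdx-between : ∀ {len i j a} → ValidIdx len i → ValidIdx len j →
  i ≤ a → a ≤ j → ValidIdx len a
validIdx-between {len} (1≤i , _) (_ , j∈len) i≤a a≤j =
  ≤-trans 1≤i i≤a , inRange-mono len a≤j j∈len

1≤2 : 1 ≤ 2
1≤2 = s≤s z≤n
1≤3 : 1 ≤ 3
1≤3 = s≤s z≤n
1≤4 : 1 ≤ 4
1≤4 = s≤s z≤n
2≤3 : 2 ≤ 3
2≤3 = s≤s 1≤2
2≤4 : 2 ≤ 4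
2≤4 = s≤s 1≤3
3≤4 : 3 ≤ 4
3≤4 = s≤s 2≤3

6≰4 : ¬ 6 ≤ 4
6≰4 (s≤s (s≤s (s≤s (s≤s ()))))

indices₂ : ℕ → ℕ → ℕ → ℕ
indices₂ a b 1 = a
indices₂ a b _ = b

indices₄ : ℕ → ℕ → ℕ → ℕ → ℕ → ℕ
indices₄ a b c d 1 = a
indices₄ a b c d 2 = b
indices₄ a b c d 3 = c
indices₄ a b c d _ = d

module _ {A : Set} (s : ℕ → A) (len : Maybe ℕ) (k : ℕ) where

  ShortKBad : Set
  ShortKBad = ∃[ r ] ∃[ idx ] ∃[ m ] (KBad s len k r idx m × r + r ≤ 4 × m ≤ 3)

  CloseRepeat : Set
  CloseRepeat =
    ∃[ i ] ∃[ j ] (ValidIdx len i × ValidIdx len j × i < j × j < i + (k + k) × s i ≡ s j)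

  pair-kBad : ∀ {a b} → ValidIdx len a → ValidIdx len b →
    b < a → a ≤ b + k → s a ≡ s b → KBad s len k 1 (indices₂ a b) 2
  pair-kBad {a} {b} va vb b<a a≤b+k sa≡sb =
    ≤-refl , valid , ≤-refl , ≤-refl , repeat , down , up , step , dip
    where
    valid : ∀ j → 1 ≤ j → j ≤ 2 → ValidIdx len (indices₂ a b j)
    valid 1 _ _ = va
    valid 2 _ _ = vb
    valid (suc (suc (suc _))) _ (s≤s (s≤s ()))
    repeat : ∀ j → 1 ≤ j → j ≤ 1 → s (indices₂ a b j) ≡ s (indices₂ a b (j + 1))
    repeat 1 _ _ = sa≡sb
    repeat (suc (suc _)) _ (s≤s ())
    down : ∀ j → 1 ≤ j → j < 2 → indices₂ a b (suc j) < indices₂ a b j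
    down 1 _ _ = b<a
    down (suc (suc _)) _ (s≤s (s≤s ()))
    up : ∀ j → 2 ≤ j → j < 2 → indices₂ a b j < indices₂ a b (suc j)
    up 1 (s≤s ()) _
    up (suc (suc _)) _ (s≤s (s≤s ()))
    step : ∀ j → 1 ≤ j → j < 2 → ∣ indices₂ a b j - indices₂ a b (suc j) ∣ ≤ k
    step 1 _ _ = subst (_≤ k) (∣-∣-comm b a) (m≤n⇒n≤m+o⇒∣m-n∣≤o (<⇒≤ b<a) a≤b+k)
    step (suc (suc _)) _ (s≤s (s≤s ()))
    dip : 2 < 2 → indices₂ a b 3 < indices₂ a b 2 + k
    dip (s≤s (s≤s ()))

  peak-kBad : ∀ {a b d} → ValidIdx len a → ValidIdx len b → ValidIdx len d →
    b < a → a < b + k → a < d → d ≤ a + k → s b ≡ s d →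
    KBad s len k 2 (indices₄ a b a d) 2
  peak-kBad {a} {b} {d} va vb vd b<a a<b+k a<d d≤a+k sb≡sd =
    1≤2 , valid , ≤-refl , 2≤4 , repeat , down , up , step , dip
    where
    valid : ∀ j → 1 ≤ j → j ≤ 4 → ValidIdx len (indices₄ a b a d j)
    valid 1 _ _ = va
    valid 2 _ _ = vb
    valid 3 _ _ = va
    valid 4 _ _ = vd
    valid (suc (suc (suc (suc (suc _))))) _ (s≤s (s≤s (s≤s (s≤s ()))))
    repeat : ∀ j → 1 ≤ j → j ≤ 2 → s (indices₄ a b a d j) ≡ s (indices₄ a b a d (j + 2))
    repeat 1 _ _ = refl
    repeat 2 _ _ = sb≡sd
    repeat (suc (suc (suc _))) _ (s≤s (s≤s ()))
    down : ∀ j → 1 ≤ j → j < 2 → indices₄ a b a d (suc j) < indices₄ a b a d j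
    down 1 _ _ = b<a
    down (suc (suc _)) _ (s≤s (s≤s ()))
    up : ∀ j → 2 ≤ j → j < 4 → indices₄ a b a d j < indices₄ a b a d (suc j)
    up 1 (s≤s ()) _
    up 2 _ _ = b<a
    up 3 _ _ = a<d
    up (suc (suc (suc (suc _)))) _ (s≤s (s≤s (s≤s (s≤s ()))))
    ∣b-a∣≤k : ∣ b - a ∣ ≤ k
    ∣b-a∣≤k = m≤n⇒n≤m+o⇒∣m-n∣≤o (<⇒≤ b<a) (<⇒≤ a<b+k)
    step : ∀ j → 1 ≤ j → j < 4 → ∣ indices₄ a b a d j - indices₄ a b a d (suc j) ∣ ≤ k
    step 1 _ _ = subst (_≤ k) (∣-∣-comm b a) ∣b-a∣≤k
    step 2 _ _ = ∣b-a∣≤k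
    step 3 _ _ = m≤n⇒n≤m+o⇒∣m-n∣≤o (<⇒≤ a<d) d≤a+k
    step (suc (suc (suc (suc _)))) _ (s≤s (s≤s (s≤s (s≤s ()))))
    dip : 2 < 4 → a < b + k
    dip _ = a<b+k

  closeRepeat-valley : ∀ {v p q y} →
    ValidIdx len v → ValidIdx len p → ValidIdx len q → ValidIdx len y →
    v < p → p ≤ v + k → v < q → q < v + k → s p ≡ s q →
    v < y → y ≤ p + k ⊎ y ≤ q + k → s v ≡ s y → CloseRepeat
  closeRepeat-valley {v} {p} {q} {y} vv vp vq vy v<p p≤v+k v<q q<v+k sp≡sq v<y y-near sv≡sy
    with <-cmp p q
  ... | tri< p<q _ _ = p , q , vp , vq , p<q ,
          m<n+o⇒m<n+[o+o] {n = p} (<-≤-trans q<v+k (+-monoˡ-≤ k (<⇒≤ v<p))) , sp≡sq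
  ... | tri> _ _ q<p = q , p , vq , vp , q<p ,
          m<n+o⇒m<n+[o+o] {n = q} (≤-<-trans p≤v+k (+-monoˡ-< k v<q)) , sym sp≡sq
  ... | tri≈ _ refl _ = v , y , vv , vy , v<y ,
          m≤n+o⇒n<p+o⇒m<p+[o+o] (reduce y-near) q<v+k , sv≡sy

  module _ (1≤k : 1 ≤ k) where

    shortKBad⇒closeRepeat : ShortKBad → CloseRepeat
    shortKBad⇒closeRepeat (0 , _ , _ , (() , _) , _)
    shortKBad⇒closeRepeat (1 , idx , m , (_ , valid , 1<m , _ , repeat , down , _ , step , _) , _) =
      idx 2 , idx 1 , valid 2 1≤2 ≤-refl , valid 1 ≤-refl 1≤2 ,
      down 1 ≤-refl 1<m ,
      m≤n+o⇒m<n+[o+o] 1≤k (∣m-n∣≤o⇒m≤n+o (step 1 ≤-refl ≤-refl)) ,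
      sym (repeat 1 ≤-refl ≤-refl)
    shortKBad⇒closeRepeat (2 , idx , 2 , (_ , valid , _ , _ , repeat , down , up , step , dip) , _) =
      closeRepeat-valley (valid 2 1≤2 2≤4) (valid 1 ≤-refl 1≤4) (valid 3 1≤3 3≤4) (valid 4 1≤4 ≤-refl)
        (down 1 ≤-refl ≤-refl) (∣m-n∣≤o⇒m≤n+o (step 1 ≤-refl 2≤4))
        (up 2 ≤-refl 3≤4) (dip 3≤4) (repeat 1 ≤-refl 1≤2)
        (<-trans (up 2 ≤-refl 3≤4) (up 3 2≤3 ≤-refl))
        (inj₂ (∣m-n∣≤o⇒n≤m+o (step 3 1≤3 ≤-refl))) (repeat 2 1≤2 ≤-refl)
    shortKBad⇒closeRepeat (2 , idx , 3 , (_ , valid , _ , _ , repeat , down , up , step , dip) , _) =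
      closeRepeat-valley (valid 3 1≤3 3≤4) (valid 2 1≤2 2≤4) (valid 4 1≤4 ≤-refl) (valid 1 ≤-refl 1≤4)
        (down 2 1≤2 ≤-refl) (∣m-n∣≤o⇒m≤n+o (step 2 1≤2 3≤4))
        (up 3 ≤-refl ≤-refl) (dip ≤-refl) (repeat 2 1≤2 ≤-refl)
        (<-trans (down 2 1≤2 ≤-refl) (down 1 ≤-refl 2≤3))
        (inj₁ (∣m-n∣≤o⇒m≤n+o (step 1 ≤-refl 2≤4))) (sym (repeat 1 ≤-refl 1≤2))
    shortKBad⇒closeRepeat (2 , _ , 0 , (_ , _ , () , _) , _)
    shortKBad⇒closeRepeat (2 , _ , 1 , (_ , _ , s≤s () , _) , _)
    shortKBad⇒closeRepeat (2 , _ , suc (suc (suc (suc _))) , _ , _ , s≤s (s≤s (s≤s ())))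
    shortKBad⇒closeRepeat (suc (suc (suc r)) , _ , _ , _ , r+r≤4 , _) =
      ⊥-elim (6≰4 (≤-trans (+-mono-≤ (m≤m+n 3 r) (m≤m+n 3 r)) r+r≤4))

    closeRepeat⇒shortKBad : CloseRepeat → ShortKBad
    closeRepeat⇒shortKBad (i , j , vi , vj , i<j , j<i+2k , si≡sj) with j ≤? i + k
    ... | yes j≤i+k = 1 , indices₂ j i , 2 ,
            pair-kBad vj vi i<j j≤i+k (sym si≡sj) , 2≤4 , 2≤3
    ... | no j≰i+k = 2 , indices₄ (j ∸ k) i (j ∸ k) j , 2 ,
            peak-kBad va vi vj i<a a<i+k a<j j≤a+k si≡sj , ≤-refl , 2≤3
      where
      i+k<j : i + k < j
      i+k<j = ≰⇒> j≰i+k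
      k≤j : k ≤ j
      k≤j = ≤-trans (m≤n+m k i) (<⇒≤ i+k<j)
      i<a : i < j ∸ k
      i<a = m+n≤o⇒m≤o∸n (suc i) i+k<j
      a<j : j ∸ k < j
      a<j = ∸-monoʳ-< 1≤k k≤j
      j≤a+k : j ≤ j ∸ k + k
      j≤a+k = subst (j ≤_) (+-comm k (j ∸ k)) (m≤n+m∸n j k)
      a<i+k : j ∸ k < i + k
      a<i+k = subst (j ∸ k <_) (m+n∸n≡m (i + k) k)
        (∸-monoˡ-< (subst (j <_) (sym (+-assoc i k k)) j<i+2k) k≤j)
      va : ValidIdx len (j ∸ k)
      va = validIdx-between vi vj (<⇒≤ i<a) (<⇒≤ a<j)

proposition4 : {A : Set} (s : ℕ → A) (len : Maybe ℕ) (k : ℕ) → 1 ≤ k →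
    (∃[ r ] ∃[ idx ] ∃[ m ] (KBad s len k r idx m × r + r ≤ 4 × m ≤ 3))
    ⇔ (∃[ i ] ∃[ j ] (ValidIdx len i × ValidIdx len j × i < j × j < i + (k + k) × s i ≡ s j))
proposition4 s len k 1≤k =
  mk⇔ (shortKBad⇒closeRepeat s len k 1≤k) (closeRepeat⇒shortKBad s len k 1≤k)
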